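{- Let $a,b,p,q$ be complex numbers with $p\neq 0$, $q\neq 0$, and let $(W_j)$, $(U_j)$, $(V_j)$ be as defined in the context. For a non-negative integer $n$ and any integers $m$ and $t$, \[ q^{mn}\sum_{k = 0}^n \binom {n + k}{k}\frac{W_{mk + t}}{V_m^k} = V_m^n W_{mn + t} - V_m^nU_m\big( W_{m(n + 1) + t + 1} - qW_{m(n + 1) + t - 1} \big)\sum_{k = 0}^{n - 1} \binom {2k + 1}{k}\frac{q^{mk}}{V_m^{2(k + 1)}} . \]
   Context: The Horadam sequence $W_j=W_j(a,b;p,q)$ is defined by $W_0=a$, $W_1=b$, $W_j=pW_{j-1}-qW_{j-2}$ for $j\ge 2$, and extended to negative indices by $W_{ -j}=\frac{1}{q}(pW_{ -j+1}-W_{ -j+2})$. The Lucas sequences are $U_j=W_j(0,1;p,q)$ and $V_j=W_j(2,p;p,q)$. -}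

module Defs where

open import Level using (Level)
open import Algebra.Bundles using (CommutativeRing; Semiring)
open import Data.Nat using (ℕ; zero; suc)
open import Data.Integer using (ℤ; +_; -[1+_])
open import Data.Product using (_×_; _,_; proj₁)

-- Everything is parameterised by a commutative ring R (instantiated in the
-- statement with a field), and elements q, qi with q * qi ≈ 1 (qi = 1/q).
module Horadam {c ℓ : Level} (R : CommutativeRing c ℓ) where
  open CommutativeRing R
  open import Algebra.Definitions.RawSemiring (Semiring.rawSemiring semiring) public using (_^_) renaming (_×_ to _·ℕ_)

  posPair : (a b p q : Carrier) → ℕ → Carrier × Carrier
  posPair a b p q zero = a , b
  posPair a b p q (suc n) with posPair a b p q n
  ... | x , y = y , (p * y - q * x)

  -- (W_{-j} , W_{-j+1}) for j ≥ 0, using W_{-j} = (1/q)(p W_{-j+1} - W_{-j+2})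
  negPair : (a b p qi : Carrier) → ℕ → Carrier × Carrier
  negPair a b p qi zero = a , b
  negPair a b p qi (suc j) with negPair a b p qi j
  ... | x , y = (qi * (p * x - y)) , x

  W : (a b p q qi : Carrier) → ℤ → Carrier
  W a b p q qi (+ n) = proj₁ (posPair a b p q n)
  W a b p q qi -[1+ j ] = proj₁ (negPair a b p qi (suc j))

  U : (p q qi : Carrier) → ℤ → Carrier
  U p q qi = W 0# 1# p q qi

  V : (p q qi : Carrier) → ℤ → Carrier
  V p q qi = W (1# + 1#) p p q qi

  -- integer powers x^z, with xi standing for 1/x
  zpow : (x xi : Carrier) → ℤ → Carrier
  zpow x xi (+ n) = x ^ n
  zpow x xi -[1+ j ] = xi ^ suc j

  sumLt : ℕ → (ℕ → Carrier) → Carrier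
  sumLt zero f = 0#
  sumLt (suc n) f = sumLt n f + f n

{-# OPTIONS --safe #-}
module Submission where

-- As functions of m ∈ ℤ, both W_{j+m} + q^m W_{j-m} and V_m W_j satisfy the Horadam recurrence
-- and agree at m = 0, 1, hence everywhere; likewise W_{j+m} - q^m W_{j-m} and
-- U_m (W_{j+1} - q W_{j-1}).  By the first identity h_k = W_{mk+t} / V_m^k satisfies
-- h_{k+2} = h_{k+1} - r h_k with r = q^m / V_m^2, and for any such sequence Pascal's rule and
-- telescoping give, by induction on n,
--   r^n Σ_{k≤n} C(n+k,k) h_k = h_n - (h_{n+2} - r h_n) Σ_{k<n} C(2k+1,k) r^k.
-- Multiplying by V_m^{2n} and rewriting h_{n+2} - r h_n by the second identity gives the theorem.

open import Defs
open import Level using (Level)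
open import Algebra.Bundles using (CommutativeRing)
open import Data.Nat using (ℕ; suc) renaming (_+_ to _+ℕ_; _*_ to _*ℕ_)
open import Data.Nat.Combinatorics using (_C_)
open import Data.Integer using (ℤ; +_) renaming (_+_ to _+ℤ_; _*_ to _*ℤ_; _-_ to _-ℤ_)
open import Data.Product using (∃)
open import Relation.Nullary using (¬_)

open import Algebra.Solver.Ring.AlmostCommutativeRing
  using (fromCommutativeRing; _-Raw-AlmostCommutative⟶_)
import Algebra.Solver.Ring as RingSolver
open import Data.Integer as ℤ using (-[1+_]; _⊖_; 1ℤ; -1ℤ)
import Data.Integer.Properties as ℤP
open import Data.Integer.Tactic.RingSolver using (solve-∀)
open import Data.Nat.Tactic.RingSolver using () renaming (solve-∀ to ℕsolve-∀)
open import Data.Maybe using (Maybe; just; nothing)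
open import Data.Nat using (zero; _∸_)
import Data.Nat.Properties as ℕP
open import Data.Nat.Combinatorics using (nCk+nC[k+1]≡[n+1]C[k+1]; nCk≡nC[n∸k])
open import Data.Product using (_×_; _,_; proj₁)
open import Function using (_∘_)
open import Relation.Binary.PropositionalEquality as ≡ using (_≡_)
open import Relation.Nullary using (yes; no)

n+[1+n]≡2n+1 : ∀ n → n +ℕ suc n ≡ 2 *ℕ n +ℕ 1
n+[1+n]≡2n+1 = ℕsolve-∀

[n+[1+n]]C[1+n]≡[2n+1]Cn : ∀ n → (n +ℕ suc n) C suc n ≡ (2 *ℕ n +ℕ 1) C n
[n+[1+n]]C[1+n]≡[2n+1]Cn n = begin
  (n +ℕ suc n) C suc n               ≡⟨ nCk≡nC[n∸k] (ℕP.m≤n+m (suc n) n) ⟩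
  (n +ℕ suc n) C (n +ℕ suc n ∸ suc n) ≡⟨ ≡.cong ((n +ℕ suc n) C_) (ℕP.m+n∸n≡m n (suc n)) ⟩
  (n +ℕ suc n) C n                   ≡⟨ ≡.cong (_C n) (n+[1+n]≡2n+1 n) ⟩
  (2 *ℕ n +ℕ 1) C n                  ∎
  where open ≡.≡-Reasoning

[[1+n]+[1+n]]C[1+n]≡[2n+1]Cn+[2n+1]Cn :
  ∀ n → (suc n +ℕ suc n) C suc n ≡ (2 *ℕ n +ℕ 1) C n +ℕ (2 *ℕ n +ℕ 1) C n
[[1+n]+[1+n]]C[1+n]≡[2n+1]Cn+[2n+1]Cn n = begin
  (suc n +ℕ suc n) C suc n                  ≡⟨ nCk+nC[k+1]≡[n+1]C[k+1] (n +ℕ suc n) n ⟨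
  (n +ℕ suc n) C n +ℕ (n +ℕ suc n) C suc n  ≡⟨ ≡.cong₂ _+ℕ_ (≡.cong (_C n) (n+[1+n]≡2n+1 n))
                                                              ([n+[1+n]]C[1+n]≡[2n+1]Cn n) ⟩
  (2 *ℕ n +ℕ 1) C n +ℕ (2 *ℕ n +ℕ 1) C n    ∎
  where open ≡.≡-Reasoning

-- ℤ.suc i and ℤ.pred i unfold to 1ℤ +ℤ i and -1ℤ +ℤ i.  The index equations below are
-- stated in the unfolded form, which the ring solver accepts, and used at suc/pred.

+-suc : ∀ i j → i +ℤ (1ℤ +ℤ j) ≡ 1ℤ +ℤ (i +ℤ j)
+-suc = solve-∀

-‿suc : ∀ i j → i -ℤ (1ℤ +ℤ j) ≡ -1ℤ +ℤ (i -ℤ j)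
-‿suc = solve-∀

-‿pred : ∀ i j → i -ℤ (-1ℤ +ℤ j) ≡ 1ℤ +ℤ (i -ℤ j)
-‿pred = solve-∀

[m[1+k]+t]+m≡m[2+k]+t : ∀ m k t → (m *ℤ (1ℤ +ℤ k) +ℤ t) +ℤ m ≡ m *ℤ (1ℤ +ℤ (1ℤ +ℤ k)) +ℤ t
[m[1+k]+t]+m≡m[2+k]+t = solve-∀

[m[1+k]+t]-m≡mk+t : ∀ m k t → (m *ℤ (1ℤ +ℤ k) +ℤ t) -ℤ m ≡ m *ℤ k +ℤ t
[m[1+k]+t]-m≡mk+t = solve-∀

-- The normaliser of Algebra.Solver.Ring can only cancel terms if equality of coefficients is
-- decidable, which it is not in R; so the coefficients are taken from ℤ, mapped into R.
module IntegerCoefficientSolver {ℓ₁ ℓ₂ : Level} (R : CommutativeRing ℓ₁ ℓ₂) where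
  open CommutativeRing R
  open Horadam R using (_·ℕ_)
  open import Algebra.Properties.Ring ring using (-0#≈0#; -‿involutive; -‿+-comm; -‿distribˡ-*; -‿distribʳ-*)
  open import Algebra.Properties.Semiring.Mult semiring using (×-homo-+; ×1-homo-*)
  open import Algebra.Properties.CommutativeSemigroup +-commutativeSemigroup using (interchange)
  open import Relation.Binary.Reasoning.Setoid setoid

  fromℤ : ℤ → Carrier
  fromℤ (+ n)    = n ·ℕ 1#
  fromℤ -[1+ n ] = - (suc n ·ℕ 1#)

  fromℤ-⊖ : ∀ m n → fromℤ (m ⊖ n) ≈ m ·ℕ 1# - n ·ℕ 1#
  fromℤ-⊖ m       zero    = sym (trans (+-congˡ -0#≈0#) (+-identityʳ _))
  fromℤ-⊖ zero    (suc n) = sym (+-identityˡ _)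
  fromℤ-⊖ (suc m) (suc n) = begin
    fromℤ (suc m ⊖ suc n)             ≡⟨ ≡.cong fromℤ (ℤP.[1+m]⊖[1+n]≡m⊖n m n) ⟩
    fromℤ (m ⊖ n)                     ≈⟨ fromℤ-⊖ m n ⟩
    m ·ℕ 1# - n ·ℕ 1#                 ≈⟨ cancel-1# (m ·ℕ 1#) (n ·ℕ 1#) ⟨
    (1# + m ·ℕ 1#) - (1# + n ·ℕ 1#)   ∎
    where
    cancel-1# : ∀ x y → (1# + x) - (1# + y) ≈ x - y
    cancel-1# x y = begin
      (1# + x) - (1# + y)     ≈⟨ +-congˡ (-‿+-comm 1# y) ⟨
      (1# + x) + (- 1# - y)   ≈⟨ interchange 1# x (- 1#) (- y) ⟩
      (1# - 1#) + (x - y)     ≈⟨ +-congʳ (-‿inverseʳ 1#) ⟩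
      0# + (x - y)            ≈⟨ +-identityˡ _ ⟩
      x - y                   ∎

  fromℤ-+ : ∀ i j → fromℤ (i +ℤ j) ≈ fromℤ i + fromℤ j
  fromℤ-+ (+ m)    (+ n)    = ×-homo-+ 1# m n
  fromℤ-+ (+ m)    -[1+ n ] = fromℤ-⊖ m (suc n)
  fromℤ-+ -[1+ m ] (+ n)    = trans (fromℤ-⊖ n (suc m)) (+-comm _ _)
  fromℤ-+ -[1+ m ] -[1+ n ] = begin
    - (suc (suc (m +ℕ n)) ·ℕ 1#)       ≡⟨ ≡.cong (λ k → - (suc k ·ℕ 1#)) (ℕP.+-suc m n) ⟨
    - ((suc m +ℕ suc n) ·ℕ 1#)         ≈⟨ -‿cong (×-homo-+ 1# (suc m) (suc n)) ⟩
    - (suc m ·ℕ 1# + suc n ·ℕ 1#)      ≈⟨ -‿+-comm _ _ ⟨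
    - (suc m ·ℕ 1#) + - (suc n ·ℕ 1#)  ∎

  fromℤ-neg : ∀ i → fromℤ (ℤ.- i) ≈ - fromℤ i
  fromℤ-neg (+ zero)  = sym -0#≈0#
  fromℤ-neg (+ suc n) = refl
  fromℤ-neg -[1+ n ]  = sym (-‿involutive _)

  fromℤ-*-+ : ∀ i n → fromℤ (i *ℤ + n) ≈ fromℤ i * fromℤ (+ n)
  fromℤ-*-+ (+ m)    n = trans (reflexive (≡.cong fromℤ (≡.sym (ℤP.pos-* m n)))) (×1-homo-* m n)
  fromℤ-*-+ -[1+ m ] n = begin
    fromℤ (ℤ.- (+ suc m) *ℤ + n)   ≡⟨ ≡.cong fromℤ (ℤP.neg-distribˡ-* (+ suc m) (+ n)) ⟨
    fromℤ (ℤ.- (+ suc m *ℤ + n))   ≈⟨ fromℤ-neg (+ suc m *ℤ + n) ⟩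
    - fromℤ (+ suc m *ℤ + n)       ≈⟨ -‿cong (fromℤ-*-+ (+ suc m) n) ⟩
    - (fromℤ (+ suc m) * fromℤ (+ n)) ≈⟨ -‿distribˡ-* _ _ ⟩
    fromℤ -[1+ m ] * fromℤ (+ n)   ∎

  fromℤ-* : ∀ i j → fromℤ (i *ℤ j) ≈ fromℤ i * fromℤ j
  fromℤ-* i (+ n)    = fromℤ-*-+ i n
  fromℤ-* i -[1+ n ] = begin
    fromℤ (i *ℤ ℤ.- (+ suc n))   ≡⟨ ≡.cong fromℤ (ℤP.neg-distribʳ-* i (+ suc n)) ⟨
    fromℤ (ℤ.- (i *ℤ + suc n))   ≈⟨ fromℤ-neg (i *ℤ + suc n) ⟩
    - fromℤ (i *ℤ + suc n)       ≈⟨ -‿cong (fromℤ-*-+ i (suc n)) ⟩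
    - (fromℤ i * fromℤ (+ suc n)) ≈⟨ -‿distribʳ-* _ _ ⟩
    fromℤ i * fromℤ -[1+ n ]     ∎

  fromℤ-homomorphism : ℤ.+-*-rawRing -Raw-AlmostCommutative⟶ fromCommutativeRing R
  fromℤ-homomorphism = record
    { ⟦_⟧    = fromℤ
    ; +-homo = fromℤ-+
    ; *-homo = fromℤ-*
    ; -‿homo = fromℤ-neg
    ; 0-homo = refl
    ; 1-homo = +-identityʳ 1#
    }

  fromℤ-≟ : ∀ i j → Maybe (fromℤ i ≈ fromℤ j)
  fromℤ-≟ i j with i ℤ.≟ j
  ... | yes i≡j = just (reflexive (≡.cong fromℤ i≡j))
  ... | no  _   = nothing

  open RingSolver ℤ.+-*-rawRing (fromCommutativeRing R) fromℤ-homomorphism fromℤ-≟ public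
    using (solve; _:=_; _:+_; _:*_; _:-_; con)

module BinomialSums {ℓ₁ ℓ₂ : Level} (R : CommutativeRing ℓ₁ ℓ₂) where
  open CommutativeRing R
  open Horadam R using (_^_; _·ℕ_; sumLt)
  open IntegerCoefficientSolver R
  open import Algebra.Properties.Semiring.Mult semiring using (×-homo-+)
  open import Algebra.Properties.CommutativeSemigroup +-commutativeSemigroup using (interchange)
  open import Algebra.Properties.CommutativeSemigroup *-commutativeSemigroup
    using (xy∙z≈y∙xz) renaming (interchange to *-interchange)
  open import Algebra.Properties.CommutativeSemiring.Exp commutativeSemiring
    using (^-congˡ; ^-assocʳ; ^-distrib-*)
  open import Relation.Binary.Reasoning.Setoid setoid

  sumLt-cong : ∀ N {f g : ℕ → Carrier} → (∀ k → f k ≈ g k) → sumLt N f ≈ sumLt N g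
  sumLt-cong zero    f≈g = refl
  sumLt-cong (suc N) f≈g = +-cong (sumLt-cong N f≈g) (f≈g N)

  *-distribˡ-sumLt : ∀ N x (f : ℕ → Carrier) → x * sumLt N f ≈ sumLt N (λ k → x * f k)
  *-distribˡ-sumLt zero    x f = zeroʳ x
  *-distribˡ-sumLt (suc N) x f = trans (distribˡ x _ _) (+-congʳ (*-distribˡ-sumLt N x f))

  sumLt-distrib-- : ∀ N (f g : ℕ → Carrier) → sumLt N (λ k → f k - g k) ≈ sumLt N f - sumLt N g
  sumLt-distrib-- zero    f g = sym (-‿inverseʳ 0#)
  sumLt-distrib-- (suc N) f g = begin
    sumLt N (λ k → f k - g k) + (f N - g N)    ≈⟨ +-congʳ (sumLt-distrib-- N f g) ⟩
    (sumLt N f - sumLt N g) + (f N - g N)      ≈⟨ solve 4 (λ F G x y → (F :- G) :+ (x :- y) := (F :+ x) :- (G :+ y))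
                                                        refl (sumLt N f) (sumLt N g) (f N) (g N) ⟩
    (sumLt N f + f N) - (sumLt N g + g N)      ∎

  binomialSum : ℕ → (ℕ → Carrier) → Carrier
  binomialSum n h = sumLt (suc n) (λ k → ((n +ℕ k) C k) ·ℕ 1# * h k)

  oddBinomialSum : ℕ → Carrier → Carrier
  oddBinomialSum n r = sumLt n (λ k → ((2 *ℕ k +ℕ 1) C k) ·ℕ 1# * r ^ k)

  NormalisedRecurrence : Carrier → (ℕ → Carrier) → Set ℓ₂
  NormalisedRecurrence r h = ∀ k → h (suc (suc k)) ≈ h (suc k) - r * h k

  sumLt-pascal : ∀ n N (h : ℕ → Carrier) →
    sumLt (suc N) (λ k → ((suc n +ℕ k) C k) ·ℕ 1# * h k)
      ≈ sumLt (suc N) (λ k → ((n +ℕ k) C k) ·ℕ 1# * h k)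
        + sumLt N (λ k → ((suc n +ℕ k) C k) ·ℕ 1# * h (suc k))
  sumLt-pascal n zero    h = sym (+-identityʳ _)
  sumLt-pascal n (suc N) h = begin
    S₁ + a+b * h (suc N)                  ≈⟨ +-cong (sumLt-pascal n N h) (*-congʳ pascal) ⟩
    (S₂ + S₃) + (a + b) * h (suc N)       ≈⟨ +-congˡ (distribʳ (h (suc N)) a b) ⟩
    (S₂ + S₃) + (a * h (suc N) + b * h (suc N)) ≈⟨ interchange S₂ S₃ _ _ ⟩
    (S₂ + a * h (suc N)) + (S₃ + b * h (suc N)) ∎
    where
    S₁ S₂ S₃ a+b a b : Carrier
    S₁ = sumLt (suc N) (λ k → ((suc n +ℕ k) C k) ·ℕ 1# * h k)
    S₂ = sumLt (suc N) (λ k → ((n +ℕ k) C k) ·ℕ 1# * h k)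
    S₃ = sumLt N (λ k → ((suc n +ℕ k) C k) ·ℕ 1# * h (suc k))
    a+b = ((suc n +ℕ suc N) C suc N) ·ℕ 1#
    a   = ((n +ℕ suc N) C suc N) ·ℕ 1#
    b   = ((suc n +ℕ N) C N) ·ℕ 1#
    pascal : a+b ≈ a + b
    pascal = begin
      ((suc n +ℕ suc N) C suc N) ·ℕ 1#
        ≡⟨ ≡.cong (_·ℕ 1#) (nCk+nC[k+1]≡[n+1]C[k+1] (n +ℕ suc N) N) ⟨
      ((n +ℕ suc N) C N +ℕ (n +ℕ suc N) C suc N) ·ℕ 1#
        ≡⟨ ≡.cong (λ m → (m C N +ℕ (n +ℕ suc N) C suc N) ·ℕ 1#) (ℕP.+-suc n N) ⟩
      (b′ +ℕ (n +ℕ suc N) C suc N) ·ℕ 1#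
        ≈⟨ ×-homo-+ 1# b′ _ ⟩
      b + a
        ≈⟨ +-comm b a ⟩
      a + b ∎
      where
      b′ : ℕ
      b′ = (suc n +ℕ N) C N

  sumLt-recurrence : ∀ {r h} → NormalisedRecurrence r h → ∀ M (c : ℕ → Carrier) →
    r * sumLt M (λ k → c k * h k)
      ≈ sumLt M (λ k → c k * h (suc k)) - sumLt M (λ k → c k * h (suc (suc k)))
  sumLt-recurrence {r} {h} rec M c = begin
    r * sumLt M (λ k → c k * h k)                            ≈⟨ *-distribˡ-sumLt M r _ ⟩
    sumLt M (λ k → r * (c k * h k))                          ≈⟨ sumLt-cong M termwise ⟩
    sumLt M (λ k → c k * h (suc k) - c k * h (suc (suc k)))  ≈⟨ sumLt-distrib-- M _ _ ⟩
    sumLt M (λ k → c k * h (suc k)) - sumLt M (λ k → c k * h (suc (suc k))) ∎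
    where
    termwise : ∀ k → r * (c k * h k) ≈ c k * h (suc k) - c k * h (suc (suc k))
    termwise k = begin
      r * (c k * h k)                         ≈⟨ solve 4 (λ r c x y → r :* (c :* x) := c :* y :- c :* (y :- r :* x))
                                                        refl r (c k) (h k) (h (suc k)) ⟩
      c k * h (suc k) - c k * (h (suc k) - r * h k) ≈⟨ +-congˡ (-‿cong (*-congˡ (rec k))) ⟨
      c k * h (suc k) - c k * h (suc (suc k)) ∎

  binomialSum-step : ∀ {r h} → NormalisedRecurrence r h → ∀ n →
    let c = ((2 *ℕ n +ℕ 1) C n) ·ℕ 1# in
    r * binomialSum (suc n) h
      ≈ (binomialSum n (h ∘ suc) + c * h (suc (suc n))) - (c + c) * h (suc (suc (suc n)))
  binomialSum-step {r} {h} rec n = begin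
    r * binomialSum (suc n) h
      ≈⟨ sumLt-recurrence rec (suc (suc n)) (λ k → ((suc n +ℕ k) C k) ·ℕ 1#) ⟩
    sumLt (suc (suc n)) (λ k → ((suc n +ℕ k) C k) ·ℕ 1# * h (suc k)) - (S + b * h₃)
      ≈⟨ +-congʳ (sumLt-pascal n (suc n) (h ∘ suc)) ⟩
    ((A + a * h₂) + S) - (S + b * h₃)
      ≈⟨ solve 3 (λ X S y → (X :+ S) :- (S :+ y) := X :- y) refl (A + a * h₂) S (b * h₃) ⟩
    (A + a * h₂) - b * h₃
      ≈⟨ +-cong (+-congˡ (*-congʳ a≈c)) (-‿cong (*-congʳ b≈c+c)) ⟩
    (A + c * h₂) - (c + c) * h₃ ∎
    where
    A S h₂ h₃ a b c : Carrier
    A  = binomialSum n (h ∘ suc)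
    S  = sumLt (suc n) (λ k → ((suc n +ℕ k) C k) ·ℕ 1# * h (suc (suc k)))
    h₂ = h (suc (suc n))
    h₃ = h (suc (suc (suc n)))
    a  = ((n +ℕ suc n) C suc n) ·ℕ 1#
    b  = ((suc n +ℕ suc n) C suc n) ·ℕ 1#
    c  = ((2 *ℕ n +ℕ 1) C n) ·ℕ 1#
    a≈c : a ≈ c
    a≈c = reflexive (≡.cong (_·ℕ 1#) ([n+[1+n]]C[1+n]≡[2n+1]Cn n))
    b≈c+c : b ≈ c + c
    b≈c+c = trans (reflexive (≡.cong (_·ℕ 1#) ([[1+n]+[1+n]]C[1+n]≡[2n+1]Cn+[2n+1]Cn n)))
                  (×-homo-+ 1# ((2 *ℕ n +ℕ 1) C n) ((2 *ℕ n +ℕ 1) C n))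

  binomialSum-closedForm : ∀ {r h} → NormalisedRecurrence r h → ∀ n →
    r ^ n * binomialSum n h ≈ h n - (h (suc (suc n)) - r * h n) * oddBinomialSum n r
  -- The solver reads the constants 0 and 1 as 0 ·ℕ 1# and 1 ·ℕ 1# = 1# + 0#, hence the first step.
  binomialSum-closedForm {r} {h} rec zero = begin
    1# * (0# + (1 ·ℕ 1#) * h 0)           ≈⟨ *-congʳ (+-identityʳ 1#) ⟨
    (1 ·ℕ 1#) * (0# + (1 ·ℕ 1#) * h 0)    ≈⟨ solve 3 (λ r h₀ h₂ → con (+ 1) :* (con (+ 0) :+ con (+ 1) :* h₀)
                                                          := h₀ :- (h₂ :- r :* h₀) :* con (+ 0))
                                                  refl r (h 0) (h 2) ⟩
    h 0 - (h 2 - r * h 0) * 0#            ∎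
  binomialSum-closedForm {r} {h} rec (suc n) = begin
    (r * r ^ n) * binomialSum (suc n) h        ≈⟨ xy∙z≈y∙xz r (r ^ n) _ ⟩
    r ^ n * (r * binomialSum (suc n) h)        ≈⟨ *-congˡ (binomialSum-step rec n) ⟩
    r ^ n * ((A + c * h₂) - (c + c) * h₃)
      ≈⟨ solve 5 (λ ρ A c h₂ h₃ → ρ :* ((A :+ c :* h₂) :- (c :+ c) :* h₃)
                                   := ρ :* A :+ ρ :* c :* (h₂ :- (h₃ :+ h₃)))
           refl (r ^ n) A c h₂ h₃ ⟩
    r ^ n * A + r ^ n * c * (h₂ - (h₃ + h₃))
      ≈⟨ +-cong (binomialSum-closedForm (λ k → rec (suc k)) n) (*-congˡ h₂-2h₃≈rh₁-h₃) ⟩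
    (h₁ - (h₃ - r * h₁) * B) + r ^ n * c * (r * h₁ - h₃)
      ≈⟨ solve 6 (λ ρ r c h₁ h₃ B → (h₁ :- (h₃ :- r :* h₁) :* B) :+ ρ :* c :* (r :* h₁ :- h₃)
                                     := h₁ :- (h₃ :- r :* h₁) :* (B :+ c :* ρ))
           refl (r ^ n) r c h₁ h₃ B ⟩
    h₁ - (h₃ - r * h₁) * (B + c * r ^ n)      ∎
    where
    A B c h₁ h₂ h₃ : Carrier
    A  = binomialSum n (h ∘ suc)
    B  = oddBinomialSum n r
    c  = ((2 *ℕ n +ℕ 1) C n) ·ℕ 1#
    h₁ = h (suc n)
    h₂ = h (suc (suc n))
    h₃ = h (suc (suc (suc n)))
    h₂-2h₃≈rh₁-h₃ : h₂ - (h₃ + h₃) ≈ r * h₁ - h₃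
    h₂-2h₃≈rh₁-h₃ = begin
      h₂ - (h₃ + h₃)              ≈⟨ solve 2 (λ x y → x :- (y :+ y) := (x :- y) :- y) refl h₂ h₃ ⟩
      (h₂ - h₃) - h₃              ≈⟨ +-congʳ (+-congˡ (-‿cong (rec (suc n)))) ⟩
      (h₂ - (h₂ - r * h₁)) - h₃   ≈⟨ +-congʳ (solve 3 (λ x y r → x :- (x :- r :* y) := r :* y) refl h₂ h₁ r) ⟩
      r * h₁ - h₃                 ∎

  x*y≈1⇒xⁿ*yⁿ≈1 : ∀ {x y} → x * y ≈ 1# → ∀ n → x ^ n * y ^ n ≈ 1#
  x*y≈1⇒xⁿ*yⁿ≈1         x*y≈1 zero    = *-identityˡ 1#
  x*y≈1⇒xⁿ*yⁿ≈1 {x} {y} x*y≈1 (suc n) = begin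
    (x * x ^ n) * (y * y ^ n)   ≈⟨ *-interchange x (x ^ n) y (y ^ n) ⟩
    (x * y) * (x ^ n * y ^ n)   ≈⟨ *-cong x*y≈1 (x*y≈1⇒xⁿ*yⁿ≈1 x*y≈1 n) ⟩
    1# * 1#                     ≈⟨ *-identityˡ 1# ⟩
    1#                          ∎

  oddBinomialSum-scaled : ∀ Q v n →
    sumLt n (λ k → ((2 *ℕ k +ℕ 1) C k) ·ℕ 1# * Q ^ k * v ^ (2 *ℕ suc k))
      ≈ (v * v) * oddBinomialSum n (Q * (v * v))
  oddBinomialSum-scaled Q v n = sym (trans (*-distribˡ-sumLt n (v * v) _) (sumLt-cong n termwise))
    where
    termwise : ∀ k → (v * v) * (((2 *ℕ k +ℕ 1) C k) ·ℕ 1# * (Q * (v * v)) ^ k)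
                     ≈ ((2 *ℕ k +ℕ 1) C k) ·ℕ 1# * Q ^ k * v ^ (2 *ℕ suc k)
    termwise k = begin
      (v * v) * (c * (Q * (v * v)) ^ k)        ≈⟨ *-congˡ (*-congˡ (^-distrib-* Q (v * v) k)) ⟩
      (v * v) * (c * (Q ^ k * (v * v) ^ k))    ≈⟨ solve 4 (λ w c q wᵏ → w :* (c :* (q :* wᵏ)) := c :* q :* (w :* wᵏ))
                                                        refl (v * v) c (Q ^ k) ((v * v) ^ k) ⟩
      c * Q ^ k * (v * v) ^ suc k              ≈⟨ *-congˡ (^-congˡ (suc k) (*-congˡ (*-identityʳ v))) ⟨
      c * Q ^ k * (v ^ 2) ^ suc k              ≈⟨ *-congˡ (^-assocʳ v 2 (suc k)) ⟩
      c * Q ^ k * v ^ (2 *ℕ suc k)             ∎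
      where
      c : Carrier
      c = ((2 *ℕ k +ℕ 1) C k) ·ℕ 1#

  binomialSum-closedForm-unnormalised : ∀ (P Q v : Carrier) (G : ℕ → Carrier) → P * v ≈ 1# →
    (∀ k → G (suc (suc k)) ≈ P * G (suc k) - Q * G k) → ∀ n →
    Q ^ n * sumLt (suc n) (λ k → ((n +ℕ k) C k) ·ℕ 1# * G k * v ^ k)
      ≈ P ^ n * G n - P ^ n * (G (suc (suc n)) - Q * G n)
          * sumLt n (λ k → ((2 *ℕ k +ℕ 1) C k) ·ℕ 1# * Q ^ k * v ^ (2 *ℕ suc k))
  binomialSum-closedForm-unnormalised P Q v G P*v≈1 rec n = begin
    Q ^ n * sumLt (suc n) (λ k → ((n +ℕ k) C k) ·ℕ 1# * G k * v ^ k)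
      ≈⟨ *-congˡ (sumLt-cong (suc n) (λ k → *-assoc _ _ _)) ⟩
    Q ^ n * binomialSum n h
      ≈⟨ *-identityˡ _ ⟨
    1# * (Q ^ n * binomialSum n h)
      ≈⟨ *-congʳ (trans (*-cong XY≈1 XY≈1) (*-identityˡ 1#)) ⟨
    (X * Y) * (X * Y) * (Q ^ n * binomialSum n h)
      ≈⟨ solve 4 (λ X Y q S → (X :* Y) :* (X :* Y) :* (q :* S) := (X :* X) :* ((q :* (Y :* Y)) :* S))
           refl X Y (Q ^ n) (binomialSum n h) ⟩
    (X * X) * ((Q ^ n * (Y * Y)) * binomialSum n h)
      ≈⟨ *-congˡ (*-congʳ rⁿ≈Qⁿ*Y*Y) ⟨
    (X * X) * (r ^ n * binomialSum n h)
      ≈⟨ *-congˡ (binomialSum-closedForm h-rec n) ⟩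
    (X * X) * (h n - (h (suc (suc n)) - r * h n) * oddBinomialSum n r)
      ≈⟨ solve 7 (λ X Y v G₀ G₂ Q B →
                    (X :* X) :* (G₀ :* Y :- (G₂ :* (v :* (v :* Y)) :- (Q :* (v :* v)) :* (G₀ :* Y)) :* B)
                    := (X :* Y) :* (X :* G₀) :- (X :* Y) :* ((X :* (G₂ :- Q :* G₀)) :* ((v :* v) :* B)))
           refl X Y v (G n) (G (suc (suc n))) Q (oddBinomialSum n r) ⟩
    (X * Y) * (X * G n) - (X * Y) * (X * (G (suc (suc n)) - Q * G n) * ((v * v) * oddBinomialSum n r))
      ≈⟨ +-cong (cancel (X * G n)) (-‿cong (cancel _)) ⟩
    X * G n - X * (G (suc (suc n)) - Q * G n) * ((v * v) * oddBinomialSum n r)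
      ≈⟨ +-congˡ (-‿cong (*-congˡ (oddBinomialSum-scaled Q v n))) ⟨
    X * G n - X * (G (suc (suc n)) - Q * G n)
      * sumLt n (λ k → ((2 *ℕ k +ℕ 1) C k) ·ℕ 1# * Q ^ k * v ^ (2 *ℕ suc k)) ∎
    where
    X Y r : Carrier
    X = P ^ n
    Y = v ^ n
    r = Q * (v * v)
    h : ℕ → Carrier
    h k = G k * v ^ k
    XY≈1 : X * Y ≈ 1#
    XY≈1 = x*y≈1⇒xⁿ*yⁿ≈1 P*v≈1 n
    cancel : ∀ x → (X * Y) * x ≈ x
    cancel x = trans (*-congʳ XY≈1) (*-identityˡ x)
    rⁿ≈Qⁿ*Y*Y : r ^ n ≈ Q ^ n * (Y * Y)
    rⁿ≈Qⁿ*Y*Y = trans (^-distrib-* Q (v * v) n) (*-congˡ (^-distrib-* v v n))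
    h-rec : NormalisedRecurrence r h
    h-rec k = begin
      G (suc (suc k)) * (v * (v * v ^ k))
        ≈⟨ *-congʳ (rec k) ⟩
      (P * G (suc k) - Q * G k) * (v * (v * v ^ k))
        ≈⟨ solve 6 (λ P Q v G₀ G₁ vᵏ → (P :* G₁ :- Q :* G₀) :* (v :* (v :* vᵏ))
                                        := (P :* v) :* (G₁ :* (v :* vᵏ)) :- (Q :* (v :* v)) :* (G₀ :* vᵏ))
             refl P Q v (G k) (G (suc k)) (v ^ k) ⟩
      (P * v) * h (suc k) - r * h k
        ≈⟨ +-congʳ (trans (*-congʳ P*v≈1) (*-identityˡ _)) ⟩
      h (suc k) - r * h k ∎

module HoradamIdentities {ℓ₁ ℓ₂ : Level} (R : CommutativeRing ℓ₁ ℓ₂) where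
  open CommutativeRing R
  open Horadam R using (W; U; V; zpow; _^_)
  open IntegerCoefficientSolver R
  open import Algebra.Properties.CommutativeSemigroup *-commutativeSemigroup using (x∙yz≈y∙xz; xy∙z≈y∙xz)
  open import Relation.Binary.Reasoning.Setoid setoid

  module WithInverse (p q qi : Carrier) (q*qi≈1 : q * qi ≈ 1#) where
    q*[qi*x]≈x : ∀ x → q * (qi * x) ≈ x
    q*[qi*x]≈x x = trans (sym (*-assoc q qi x)) (trans (*-congʳ q*qi≈1) (*-identityˡ x))

    qi*[q*x]≈x : ∀ x → qi * (q * x) ≈ x
    qi*[q*x]≈x x = trans (x∙yz≈y∙xz qi q x) (q*[qi*x]≈x x)

    *-cancelˡ-q : ∀ {x y} → q * x ≈ q * y → x ≈ y
    *-cancelˡ-q {x} {y} qx≈qy = trans (sym (qi*[q*x]≈x x)) (trans (*-congˡ qx≈qy) (qi*[q*x]≈x y))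

    zpow-suc : ∀ i → zpow q qi (ℤ.suc i) ≈ q * zpow q qi i
    zpow-suc (+ n)          = refl
    zpow-suc -[1+ zero ]    = sym (q*[qi*x]≈x 1#)
    zpow-suc -[1+ suc n ]   = sym (q*[qi*x]≈x _)

    zpow-pred : ∀ i → zpow q qi (ℤ.pred i) ≈ qi * zpow q qi i
    zpow-pred (+ zero)  = refl
    zpow-pred (+ suc n) = sym (qi*[q*x]≈x _)
    zpow-pred -[1+ n ]  = refl

    q*zpow-pred≈zpow : ∀ i → q * zpow q qi (ℤ.pred i) ≈ zpow q qi i
    q*zpow-pred≈zpow i = trans (*-congˡ (zpow-pred i)) (q*[qi*x]≈x _)

    zpow-+-suc : ∀ i j → zpow q qi (i +ℤ j) ≈ zpow q qi i * zpow q qi j →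
                 zpow q qi (i +ℤ ℤ.suc j) ≈ zpow q qi i * zpow q qi (ℤ.suc j)
    zpow-+-suc i j hyp = begin
      zpow q qi (i +ℤ ℤ.suc j)          ≡⟨ ≡.cong (zpow q qi) (+-suc i j) ⟩
      zpow q qi (ℤ.suc (i +ℤ j))        ≈⟨ zpow-suc (i +ℤ j) ⟩
      q * zpow q qi (i +ℤ j)            ≈⟨ *-congˡ hyp ⟩
      q * (zpow q qi i * zpow q qi j)   ≈⟨ x∙yz≈y∙xz q _ _ ⟩
      zpow q qi i * (q * zpow q qi j)   ≈⟨ *-congˡ (zpow-suc j) ⟨
      zpow q qi i * zpow q qi (ℤ.suc j) ∎

    zpow-+-pred : ∀ i j → zpow q qi (i +ℤ j) ≈ zpow q qi i * zpow q qi j →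
                  zpow q qi (i +ℤ ℤ.pred j) ≈ zpow q qi i * zpow q qi (ℤ.pred j)
    zpow-+-pred i j hyp = begin
      zpow q qi (i +ℤ ℤ.pred j)          ≡⟨ ≡.cong (zpow q qi) (ℤP.+-pred i j) ⟩
      zpow q qi (ℤ.pred (i +ℤ j))        ≈⟨ zpow-pred (i +ℤ j) ⟩
      qi * zpow q qi (i +ℤ j)            ≈⟨ *-congˡ hyp ⟩
      qi * (zpow q qi i * zpow q qi j)   ≈⟨ x∙yz≈y∙xz qi _ _ ⟩
      zpow q qi i * (qi * zpow q qi j)   ≈⟨ *-congˡ (zpow-pred j) ⟨
      zpow q qi i * zpow q qi (ℤ.pred j) ∎

    zpow-+ : ∀ i j → zpow q qi (i +ℤ j) ≈ zpow q qi i * zpow q qi j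
    zpow-+ i (+ zero)      = trans (reflexive (≡.cong (zpow q qi) (ℤP.+-identityʳ i))) (sym (*-identityʳ _))
    zpow-+ i (+ suc n)     = zpow-+-suc i (+ n) (zpow-+ i (+ n))
    zpow-+ i -[1+ zero ]   = zpow-+-pred i (+ 0) (zpow-+ i (+ 0))
    zpow-+ i -[1+ suc n ]  = zpow-+-pred i -[1+ n ] (zpow-+ i -[1+ n ])

    zpow-* : ∀ i n → zpow q qi (i *ℤ + n) ≈ zpow q qi i ^ n
    zpow-* i zero    = reflexive (≡.cong (zpow q qi) (ℤP.*-zeroʳ i))
    zpow-* i (suc n) = begin
      zpow q qi (i *ℤ + suc n)             ≡⟨ ≡.cong (zpow q qi) (ℤP.*-suc i (+ n)) ⟩
      zpow q qi (i +ℤ i *ℤ + n)            ≈⟨ zpow-+ i (i *ℤ + n) ⟩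
      zpow q qi i * zpow q qi (i *ℤ + n)   ≈⟨ *-congˡ (zpow-* i n) ⟩
      zpow q qi i * zpow q qi i ^ n        ∎

    IsHoradam : (ℤ → Carrier) → Set ℓ₂
    IsHoradam f = ∀ j → f (ℤ.suc j) ≈ p * f j - q * f (ℤ.pred j)

    forward-backward : ∀ x y → y ≈ p * x - q * (qi * (p * x - y))
    forward-backward x y = sym (begin
      p * x - q * (qi * (p * x - y))  ≈⟨ +-congˡ (-‿cong (q*[qi*x]≈x _)) ⟩
      p * x - (p * x - y)             ≈⟨ solve 2 (λ x y → x :- (x :- y) := y) refl (p * x) y ⟩
      y                               ∎)

    W-isHoradam : ∀ a b → IsHoradam (W a b p q qi)
    W-isHoradam a b (+ zero)      = forward-backward a b
    W-isHoradam a b (+ suc n)     = refl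
    W-isHoradam a b -[1+ zero ]   = forward-backward _ _
    W-isHoradam a b -[1+ suc n ]  = forward-backward _ _

    module _ {f : ℤ → Carrier} (f-rec : IsHoradam f) where
      IsHoradam-backward : ∀ j → q * f (ℤ.pred j) ≈ p * f j - f (ℤ.suc j)
      IsHoradam-backward j = sym (begin
        p * f j - f (ℤ.suc j)                           ≈⟨ +-congˡ (-‿cong (f-rec j)) ⟩
        p * f j - (p * f j - q * f (ℤ.pred j))          ≈⟨ solve 2 (λ x y → x :- (x :- y) := y) refl (p * f j) _ ⟩
        q * f (ℤ.pred j)                                ∎)

      IsHoradam-*ʳ : ∀ x → IsHoradam (λ j → f j * x)
      IsHoradam-*ʳ x j = begin
        f (ℤ.suc j) * x                              ≈⟨ *-congʳ (f-rec j) ⟩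
        (p * f j - q * f (ℤ.pred j)) * x             ≈⟨ solve 5 (λ p q y y′ x → (p :* y :- q :* y′) :* x := p :* (y :* x) :- q :* (y′ :* x))
                                                            refl p q (f j) (f (ℤ.pred j)) x ⟩
        p * (f j * x) - q * (f (ℤ.pred j) * x)       ∎

      IsHoradam-shift : ∀ i → IsHoradam (λ j → f (i +ℤ j))
      IsHoradam-shift i j = begin
        f (i +ℤ ℤ.suc j)                          ≡⟨ ≡.cong f (+-suc i j) ⟩
        f (ℤ.suc (i +ℤ j))                        ≈⟨ f-rec (i +ℤ j) ⟩
        p * f (i +ℤ j) - q * f (ℤ.pred (i +ℤ j))  ≡⟨ ≡.cong (λ k → p * f (i +ℤ j) - q * f k) (ℤP.+-pred i j) ⟨
        p * f (i +ℤ j) - q * f (i +ℤ ℤ.pred j)    ∎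

      IsHoradam-reflect : ∀ i → IsHoradam (λ j → zpow q qi j * f (i -ℤ j))
      IsHoradam-reflect i j = begin
        zpow q qi (ℤ.suc j) * f (i -ℤ ℤ.suc j)
          ≈⟨ *-cong (zpow-suc j) (reflexive (≡.cong f (-‿suc i j))) ⟩
        (q * zpow q qi j) * f (ℤ.pred (i -ℤ j))
          ≈⟨ xy∙z≈y∙xz q _ _ ⟩
        zpow q qi j * (q * f (ℤ.pred (i -ℤ j)))
          ≈⟨ *-congˡ (IsHoradam-backward (i -ℤ j)) ⟩
        zpow q qi j * (p * f (i -ℤ j) - f (ℤ.suc (i -ℤ j)))
          ≈⟨ solve 4 (λ z p x y → z :* (p :* x :- y) := p :* (z :* x) :- z :* y)
               refl (zpow q qi j) p (f (i -ℤ j)) (f (ℤ.suc (i -ℤ j))) ⟩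
        p * (zpow q qi j * f (i -ℤ j)) - zpow q qi j * f (ℤ.suc (i -ℤ j))
          ≈⟨ +-congˡ (-‿cong (*-congʳ (q*zpow-pred≈zpow j))) ⟨
        p * (zpow q qi j * f (i -ℤ j)) - (q * zpow q qi (ℤ.pred j)) * f (ℤ.suc (i -ℤ j))
          ≈⟨ +-congˡ (-‿cong (*-assoc q _ _)) ⟩
        p * (zpow q qi j * f (i -ℤ j)) - q * (zpow q qi (ℤ.pred j) * f (ℤ.suc (i -ℤ j)))
          ≡⟨ ≡.cong (λ k → p * (zpow q qi j * f (i -ℤ j)) - q * (zpow q qi (ℤ.pred j) * f k)) (-‿pred i j) ⟨
        p * (zpow q qi j * f (i -ℤ j)) - q * (zpow q qi (ℤ.pred j) * f (i -ℤ ℤ.pred j)) ∎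

    module _ {f g : ℤ → Carrier} (f-rec : IsHoradam f) (g-rec : IsHoradam g) where
      IsHoradam-+ : IsHoradam (λ j → f j + g j)
      IsHoradam-+ j = begin
        f (ℤ.suc j) + g (ℤ.suc j)
          ≈⟨ +-cong (f-rec j) (g-rec j) ⟩
        (p * f j - q * f (ℤ.pred j)) + (p * g j - q * g (ℤ.pred j))
          ≈⟨ solve 6 (λ p q x x′ y y′ → (p :* x :- q :* x′) :+ (p :* y :- q :* y′) := p :* (x :+ y) :- q :* (x′ :+ y′))
               refl p q (f j) (f (ℤ.pred j)) (g j) (g (ℤ.pred j)) ⟩
        p * (f j + g j) - q * (f (ℤ.pred j) + g (ℤ.pred j)) ∎

      IsHoradam-− : IsHoradam (λ j → f j - g j)
      IsHoradam-− j = begin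
        f (ℤ.suc j) - g (ℤ.suc j)
          ≈⟨ +-cong (f-rec j) (-‿cong (g-rec j)) ⟩
        (p * f j - q * f (ℤ.pred j)) - (p * g j - q * g (ℤ.pred j))
          ≈⟨ solve 6 (λ p q x x′ y y′ → (p :* x :- q :* x′) :- (p :* y :- q :* y′) := p :* (x :- y) :- q :* (x′ :- y′))
               refl p q (f j) (f (ℤ.pred j)) (g j) (g (ℤ.pred j)) ⟩
        p * (f j - g j) - q * (f (ℤ.pred j) - g (ℤ.pred j)) ∎

      agree-suc : ∀ j → f (ℤ.pred j) ≈ g (ℤ.pred j) → f j ≈ g j → f (ℤ.suc j) ≈ g (ℤ.suc j)
      agree-suc j f≈g₋ f≈g = trans (f-rec j) (trans (+-cong (*-congˡ f≈g) (-‿cong (*-congˡ f≈g₋))) (sym (g-rec j)))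

      agree-pred : ∀ j → f j ≈ g j → f (ℤ.suc j) ≈ g (ℤ.suc j) → f (ℤ.pred j) ≈ g (ℤ.pred j)
      agree-pred j f≈g f≈g₊ = *-cancelˡ-q (begin
        q * f (ℤ.pred j)        ≈⟨ IsHoradam-backward f-rec j ⟩
        p * f j - f (ℤ.suc j)   ≈⟨ +-cong (*-congˡ f≈g) (-‿cong f≈g₊) ⟩
        p * g j - g (ℤ.suc j)   ≈⟨ IsHoradam-backward g-rec j ⟨
        q * g (ℤ.pred j)        ∎)

      IsHoradam-unique : f (+ 0) ≈ g (+ 0) → f (+ 1) ≈ g (+ 1) → ∀ j → f j ≈ g j
      IsHoradam-unique f₀≈g₀ f₁≈g₁ (+ n)    = proj₁ (agree⁺ n)
        where
        agree⁺ : ∀ n → f (+ n) ≈ g (+ n) × f (+ suc n) ≈ g (+ suc n)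
        agree⁺ zero    = f₀≈g₀ , f₁≈g₁
        agree⁺ (suc n) with agree⁺ n
        ... | fₙ≈gₙ , fₙ₊₁≈gₙ₊₁ = fₙ₊₁≈gₙ₊₁ , agree-suc (+ suc n) fₙ≈gₙ fₙ₊₁≈gₙ₊₁
      IsHoradam-unique f₀≈g₀ f₁≈g₁ -[1+ n ] = proj₁ (agree⁻ n)
        where
        agree⁻ : ∀ n → f -[1+ n ] ≈ g -[1+ n ] × f (ℤ.suc -[1+ n ]) ≈ g (ℤ.suc -[1+ n ])
        agree⁻ zero    = agree-pred (+ 0) f₀≈g₀ f₁≈g₁ , f₀≈g₀
        agree⁻ (suc n) with agree⁻ n
        ... | fₙ≈gₙ , fₙ₊₁≈gₙ₊₁ = agree-pred -[1+ n ] fₙ≈gₙ fₙ₊₁≈gₙ₊₁ , fₙ≈gₙ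

    module _ (a b : Carrier) where
      private
        w : ℤ → Carrier
        w = W a b p q qi

      W[j+m]+qᵐW[j-m]≈VₘWⱼ : ∀ j m → w (j +ℤ m) + zpow q qi m * w (j -ℤ m) ≈ V p q qi m * w j
      W[j+m]+qᵐW[j-m]≈VₘWⱼ j = IsHoradam-unique
        (IsHoradam-+ (IsHoradam-shift (W-isHoradam a b) j) (IsHoradam-reflect (W-isHoradam a b) j))
        (IsHoradam-*ʳ (W-isHoradam (1# + 1#) p) (w j))
        at-0 at-1
        where
        at-0 : w (j +ℤ + 0) + 1# * w (j -ℤ + 0) ≈ (1# + 1#) * w j
        at-0 = begin
          w (j +ℤ + 0) + 1# * w (j -ℤ + 0)  ≡⟨ ≡.cong (λ i → w i + 1# * w i) (ℤP.+-identityʳ j) ⟩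
          w j + 1# * w j                    ≈⟨ +-congʳ (*-identityˡ (w j)) ⟨
          1# * w j + 1# * w j               ≈⟨ distribʳ (w j) 1# 1# ⟨
          (1# + 1#) * w j                   ∎
        at-1 : w (j +ℤ + 1) + (q * 1#) * w (j -ℤ + 1) ≈ p * w j
        at-1 = begin
          w (j +ℤ + 1) + (q * 1#) * w (j -ℤ + 1)
            ≡⟨ ≡.cong₂ (λ i k → w i + (q * 1#) * w k) (ℤP.+-comm j (+ 1)) (ℤP.+-comm j -1ℤ) ⟩
          w (ℤ.suc j) + (q * 1#) * w (ℤ.pred j)
            ≈⟨ +-cong (W-isHoradam a b j) (*-congʳ (*-identityʳ q)) ⟩
          (p * w j - q * w (ℤ.pred j)) + q * w (ℤ.pred j)
            ≈⟨ solve 2 (λ x y → (x :- y) :+ y := x) refl (p * w j) (q * w (ℤ.pred j)) ⟩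
          p * w j ∎

      W[j+m]-qᵐW[j-m]≈Uₘ[W[j+1]-qW[j-1]] :
        ∀ j m → w (j +ℤ m) - zpow q qi m * w (j -ℤ m) ≈ U p q qi m * (w (j +ℤ + 1) - q * w (j -ℤ + 1))
      W[j+m]-qᵐW[j-m]≈Uₘ[W[j+1]-qW[j-1]] j = IsHoradam-unique
        (IsHoradam-− (IsHoradam-shift (W-isHoradam a b) j) (IsHoradam-reflect (W-isHoradam a b) j))
        (IsHoradam-*ʳ (W-isHoradam 0# 1#) (w (j +ℤ + 1) - q * w (j -ℤ + 1)))
        at-0 at-1
        where
        at-0 : w (j +ℤ + 0) - 1# * w (j -ℤ + 0) ≈ 0# * (w (j +ℤ + 1) - q * w (j -ℤ + 1))
        at-0 = begin
          w (j +ℤ + 0) - 1# * w (j -ℤ + 0)  ≈⟨ +-congˡ (-‿cong (*-identityˡ _)) ⟩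
          w (j +ℤ + 0) - w (j +ℤ + 0)       ≈⟨ -‿inverseʳ _ ⟩
          0#                                ≈⟨ zeroˡ _ ⟨
          0# * (w (j +ℤ + 1) - q * w (j -ℤ + 1)) ∎
        at-1 : w (j +ℤ + 1) - (q * 1#) * w (j -ℤ + 1) ≈ 1# * (w (j +ℤ + 1) - q * w (j -ℤ + 1))
        at-1 = trans (+-congˡ (-‿cong (*-congʳ (*-identityʳ q)))) (sym (*-identityˡ _))

      W-progression-recurrence : ∀ m t k →
        w (m *ℤ + suc (suc k) +ℤ t) ≈ V p q qi m * w (m *ℤ + suc k +ℤ t) - zpow q qi m * w (m *ℤ + k +ℤ t)
      W-progression-recurrence m t k = begin
        w (m *ℤ + suc (suc k) +ℤ t)
          ≈⟨ solve 2 (λ x y → x := (x :+ y) :- y) refl _ _ ⟩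
        (w (m *ℤ + suc (suc k) +ℤ t) + qᵐw₀) - qᵐw₀
          ≡⟨ ≡.cong₂ (λ x y → (w x + zpow q qi m * w y) - qᵐw₀)
                     ([m[1+k]+t]+m≡m[2+k]+t m (+ k) t) ([m[1+k]+t]-m≡mk+t m (+ k) t) ⟨
        (w (j +ℤ m) + zpow q qi m * w (j -ℤ m)) - qᵐw₀
          ≈⟨ +-congʳ (W[j+m]+qᵐW[j-m]≈VₘWⱼ j m) ⟩
        V p q qi m * w j - qᵐw₀ ∎
        where
        j : ℤ
        j = m *ℤ + suc k +ℤ t
        qᵐw₀ : Carrier
        qᵐw₀ = zpow q qi m * w (m *ℤ + k +ℤ t)

      W-progression-difference : ∀ m t n →
        w (m *ℤ + suc (suc n) +ℤ t) - zpow q qi m * w (m *ℤ + n +ℤ t)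
          ≈ U p q qi m * (w (m *ℤ + suc n +ℤ t +ℤ + 1) - q * w (m *ℤ + suc n +ℤ t -ℤ + 1))
      W-progression-difference m t n = begin
        w (m *ℤ + suc (suc n) +ℤ t) - zpow q qi m * w (m *ℤ + n +ℤ t)
          ≡⟨ ≡.cong₂ (λ x y → w x - zpow q qi m * w y)
                     ([m[1+k]+t]+m≡m[2+k]+t m (+ n) t) ([m[1+k]+t]-m≡mk+t m (+ n) t) ⟨
        w (j +ℤ m) - zpow q qi m * w (j -ℤ m)
          ≈⟨ W[j+m]-qᵐW[j-m]≈Uₘ[W[j+1]-qW[j-1]] j m ⟩
        U p q qi m * (w (j +ℤ + 1) - q * w (j -ℤ + 1)) ∎
        where
        j : ℤ
        j = m *ℤ + suc n +ℤ t

theorem15 : {c ℓ : Level} (R : CommutativeRing c ℓ) →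
  let open CommutativeRing R
      open Horadam R
  in ¬ (1# ≈ 0#) →
     (∀ x → ¬ (x ≈ 0#) → ∃ λ y → x * y ≈ 1#) →
     (a b p q qi : Carrier) → ¬ (p ≈ 0#) → ¬ (q ≈ 0#) → q * qi ≈ 1# →
     (n : ℕ) (m t : ℤ) →
     (vi : Carrier) → V p q qi m * vi ≈ 1# →
     let Wz = W a b p q qi
         Vm = V p q qi m
         Um = U p q qi m
     in zpow q qi (m *ℤ (+ n)) *
          sumLt (suc n) (λ k → (((n +ℕ k) C k) ·ℕ 1#) * Wz (m *ℤ (+ k) +ℤ t) * vi ^ k)
        ≈ Vm ^ n * Wz (m *ℤ (+ n) +ℤ t)
          - Vm ^ n * Um
            * (Wz (m *ℤ (+ suc n) +ℤ t +ℤ + 1) - q * Wz (m *ℤ (+ suc n) +ℤ t -ℤ + 1))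
            * sumLt n (λ k → (((2 *ℕ k +ℕ 1) C k) ·ℕ 1#)
                               * zpow q qi (m *ℤ (+ k)) * vi ^ (2 *ℕ suc k))
theorem15 R _ _ a b p q qi _ _ q*qi≈1 n m t vi Vₘ*vi≈1 = begin
  zpow q qi (m *ℤ + n) * sumLt (suc n) (λ k → ((n +ℕ k) C k) ·ℕ 1# * G k * vi ^ k)
    ≈⟨ *-congʳ (zpow-* m n) ⟩
  Q ^ n * sumLt (suc n) (λ k → ((n +ℕ k) C k) ·ℕ 1# * G k * vi ^ k)
    ≈⟨ binomialSum-closedForm-unnormalised Vₘ Q vi G Vₘ*vi≈1 (W-progression-recurrence a b m t) n ⟩
  Vₘ ^ n * G n - Vₘ ^ n * (G (suc (suc n)) - Q * G n) * T′
    ≈⟨ +-congˡ (-‿cong (*-cong (trans (*-congˡ (W-progression-difference a b m t n)) (sym (*-assoc _ _ _)))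
                               (sumLt-cong n (λ k → *-congʳ (*-congˡ (sym (zpow-* m k))))))) ⟩
  Vₘ ^ n * G n - Vₘ ^ n * U p q qi m * D * T ∎
  where
  open CommutativeRing R
  open Horadam R
  open BinomialSums R using (binomialSum-closedForm-unnormalised; sumLt-cong)
  open HoradamIdentities.WithInverse R p q qi q*qi≈1
  open import Relation.Binary.Reasoning.Setoid setoid

  Q Vₘ : Carrier
  Q  = zpow q qi m
  Vₘ = V p q qi m
  G : ℕ → Carrier
  G k = W a b p q qi (m *ℤ + k +ℤ t)
  D T′ T : Carrier
  D = W a b p q qi (m *ℤ + suc n +ℤ t +ℤ + 1) - q * W a b p q qi (m *ℤ + suc n +ℤ t -ℤ + 1)
  T′ = sumLt n (λ k → ((2 *ℕ k +ℕ 1) C k) ·ℕ 1# * Q ^ k * vi ^ (2 *ℕ suc k))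
  T  = sumLt n (λ k → ((2 *ℕ k +ℕ 1) C k) ·ℕ 1# * zpow q qi (m *ℤ + k) * vi ^ (2 *ℕ suc k))
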